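{- The satisfaction system $\Lambda_{\mathrm{ABox}}$, whose language consists only of positive and negative description logic assertions, is not reception-compatible but it is eviction-compatible.
   Context: Let $N_C,N_R,N_I$ be countably infinite, pairwise disjoint sets of concept, role and individual names. The language of $\Lambda_{\mathrm{ABox}}$ consists of assertions $A(a)$, $r(a,b)$, $\neg A(a)$, $\neg r(a,b)$ with $A\in N_C$, $r\in N_R$, $a,b\in N_I$. Models are interpretations $I=(\Delta^I,\cdot^I)$ with $\Delta^I$ non-empty, $A^I\subseteq\Delta^I$, $r^I\subseteq\Delta^I\times\Delta^I$, $a^I\in\Delta^I$; $I\models A(a)$ iff $a^I\in A^I$, $I\models r(a,b)$ iff $(a^I,b^I)\in r^I$, $I\models\neg A(a)$ iff $a^I\notin A^I$, $I\models\neg r(a,b)$ iff $(a^I,b^I)\notin r^I$, and $I\models B$ iff $I$ satisfies every assertion in $B$. For a satisfaction system $\Lambda=(\mathcal{L},\mathfrak{M},\models)$: $\mathrm{Mod}(B)=\{m\in\mathfrak{M}\mid m\models B\}$; $\mathrm{FR}(\Lambda)=\{\mathrm{Mod}(B)\mid B\subseteq\mathcal{L}$ finite$\}$; $\mathrm{FRsubs}(\mathbb{M},\Lambda)$ is the set of $\subseteq$-maximal elements of $\{Y\in\mathrm{FR}(\Lambda)\mid Y\subseteq\mathbb{M}\}$ and $\mathrm{FRsups}(\mathbb{M},\Lambda)$ the set of $\subseteq$-minimal elements of $\{Y\in\mathrm{FR}(\Lambda)\mid\mathbb{M}\subseteq Y\}$. $\Lambda$ is eviction-compatible if $\mathrm{FRsubs}(\mathrm{Mod}(B)\setminus\mathbb{M},\Lambda)\neq\emptyset$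 for all finite $B\subseteq\mathcal{L}$ and sets of models $\mathbb{M}$; it is reception-compatible if $\mathrm{FRsups}(\mathrm{Mod}(B)\cup\mathbb{M},\Lambda)\neq\emptyset$ for all finite $B$ and $\mathbb{M}$. -}

module Defs where

open import Level using (Level; 0ℓ) renaming (suc to lsuc)
open import Data.Nat using (ℕ)
open import Data.List using (List)
open import Data.List.Relation.Unary.All using (All)
open import Data.Product using (Σ; _×_; ∃)
open import Relation.Nullary using (¬_)
open import Relation.Unary using (Pred; _⊆_; _∪_)

-- Names: concept, role and individual names are each indexed by ℕ
-- (countably infinite); disjointness is by the constructor tags below.
ConceptName RoleName IndName : Set
ConceptName = ℕ
RoleName    = ℕ
IndName     = ℕ

data Assertion : Set where
  cpos : ConceptName → IndName → Assertion
  rpos : RoleName → IndName → IndName → Assertion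
  cneg : ConceptName → IndName → Assertion
  rneg : RoleName → IndName → IndName → Assertion

record Interpretation : Set₁ where
  field
    Δ    : Set
    elt  : Δ                          -- witness of non-emptiness
    conc : ConceptName → Δ → Set
    role : RoleName → Δ → Δ → Set
    ind  : IndName → Δ
open Interpretation public

_⊨_ : Interpretation → Assertion → Set
I ⊨ cpos A a   = conc I A (ind I a)
I ⊨ rpos r a b = role I r (ind I a) (ind I b)
I ⊨ cneg A a   = ¬ conc I A (ind I a)
I ⊨ rneg r a b = ¬ role I r (ind I a) (ind I b)

ModelSet : Set₁
ModelSet = Pred Interpretation 0ℓ

Base : Set
Base = List Assertion

Mod : Base → ModelSet
Mod B I = All (I ⊨_) B

_≐_ : ModelSet → ModelSet → Set₁
X ≐ Y = (X ⊆ Y) × (Y ⊆ X)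

InFR : ModelSet → Set₁
InFR Y = Σ Base λ B → Y ≐ Mod B

_∖_ : ModelSet → ModelSet → ModelSet
(X ∖ Y) I = X I × ¬ Y I

IsFRsub : ModelSet → ModelSet → Set₁
IsFRsub 𝕄 Y = InFR Y × (Y ⊆ 𝕄)
  × (∀ (Y′ : ModelSet) → InFR Y′ → Y′ ⊆ 𝕄 → Y ⊆ Y′ → Y′ ⊆ Y)

IsFRsup : ModelSet → ModelSet → Set₁
IsFRsup 𝕄 Y = InFR Y × (𝕄 ⊆ Y)
  × (∀ (Y′ : ModelSet) → InFR Y′ → 𝕄 ⊆ Y′ → Y′ ⊆ Y → Y ⊆ Y′)

FRsubs-nonempty FRsups-nonempty : ModelSet → Set₁
FRsubs-nonempty 𝕄 = ∃ λ Y → IsFRsub 𝕄 Y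
FRsups-nonempty 𝕄 = ∃ λ Y → IsFRsup 𝕄 Y

EvictionCompatible : Set₁
EvictionCompatible = (B : Base) (𝕄 : ModelSet) → FRsubs-nonempty (Mod B ∖ 𝕄)

ReceptionCompatible : Set₁
ReceptionCompatible = (B : Base) (𝕄 : ModelSet) → FRsups-nonempty (Mod B ∪ 𝕄)

{-# OPTIONS --safe #-}
-- Reception fails for the unsatisfiable base and the set 𝕄 of interpretations in which every
-- individual belongs to A₀: a finite base true throughout 𝕄 mentions only finitely many
-- individuals, so it has a model in which a fresh individual k is not in A₀, and adding A₀(k)
-- to it gives a strictly smaller finitely representable superset of 𝕄.
--
-- Eviction works because entailment between satisfiable bases is syntactic: if B is
-- satisfiable and Mod B ⊆ Mod B′, then every assertion of B′ already occurs in B (a canonical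
-- model of B refutes any assertion outside B). Hence, choosing by excluded middle a shortest
-- satisfiable base whose models all lie in Mod B ∖ 𝕄, its model set is maximal; if there is
-- none, the empty set is maximal.
module Submission where

open import Defs
open import Level using (_⊔_; 0ℓ) renaming (suc to lsuc)
open import Function using (_∘_)
open import Data.Product using (_×_; _,_; proj₁; proj₂; ∃)
import Data.Product.Properties as Product
open import Data.Sum using (_⊎_; inj₁; inj₂)
import Data.Sum.Properties as Sum
open import Data.Empty using (⊥; ⊥-elim)
open import Data.Nat using (ℕ; suc; _≤_; _<_; s≤s)
open import Data.Nat.Induction using (<-wellFounded)
open import Data.Nat.Properties using (≤-trans; m≤m+n; m≤n+m; <⇒≢; ≮⇒≥; <-≤-trans; n≮n)
import Data.Nat.Properties as ℕ
open import Data.List using ([]; _∷_; length; filter; map)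
open import Data.Nat.ListAction using (sum)
open import Data.List.Properties using (filter-notAll)
open import Data.List.Relation.Unary.All as All using (All; []; _∷_)
open import Data.List.Relation.Unary.All.Properties using (anti-mono; ¬All⇒Any¬)
open import Data.List.Relation.Unary.Any using (here; there)
import Data.List.Relation.Binary.Subset.Propositional as List
open import Data.List.Membership.Propositional using (_∈_)
open import Data.List.Membership.Propositional.Properties using (∈-filter⁺; ∈-filter⁻)
open import Induction.WellFounded using (Acc; acc)
open import Relation.Binary using (DecidableEquality)
open import Relation.Binary.PropositionalEquality using (_≡_; refl; sym; trans; cong)
open import Relation.Nullary using (¬_; yes; no; map′; contradiction)
open import Relation.Unary using (Pred; _⊆_; _∪_)
open import Axiom.ExcludedMiddle using (ExcludedMiddle)

module _ {a p} {A : Set a} {P : Pred A p} where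

  lem⇒minimal : ExcludedMiddle (a ⊔ p) → (μ : A → ℕ) →
                ∃ P → ∃ λ x → P x × (∀ {y} → P y → μ x ≤ μ y)
  lem⇒minimal lem μ (x , px) = descend x px (<-wellFounded (μ x))
    where
    descend : ∀ x → P x → Acc _<_ (μ x) → ∃ λ x → P x × (∀ {y} → P y → μ x ≤ μ y)
    descend x px (acc rs) with lem {∃ λ y → P y × μ y < μ x}
    ... | yes (y , py , μy<μx) = descend y py (rs μy<μx)
    ... | no  none             = x , px , λ py → ≮⇒≥ (λ μy<μx → none (_ , py , μy<μx))

AssertionCode : Set
AssertionCode = (ℕ × ℕ) ⊎ (ℕ × ℕ × ℕ) ⊎ (ℕ × ℕ) ⊎ (ℕ × ℕ × ℕ)

encode : Assertion → AssertionCode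
encode (cpos A a)   = inj₁ (A , a)
encode (rpos r a b) = inj₂ (inj₁ (r , a , b))
encode (cneg A a)   = inj₂ (inj₂ (inj₁ (A , a)))
encode (rneg r a b) = inj₂ (inj₂ (inj₂ (r , a , b)))

decode : AssertionCode → Assertion
decode (inj₁ (A , a))                   = cpos A a
decode (inj₂ (inj₁ (r , a , b)))        = rpos r a b
decode (inj₂ (inj₂ (inj₁ (A , a))))     = cneg A a
decode (inj₂ (inj₂ (inj₂ (r , a , b)))) = rneg r a b

decode-encode : ∀ α → decode (encode α) ≡ α
decode-encode (cpos A a)   = refl
decode-encode (rpos r a b) = refl
decode-encode (cneg A a)   = refl
decode-encode (rneg r a b) = refl

encode-injective : ∀ {α β} → encode α ≡ encode β → α ≡ β
encode-injective {α} {β} eq =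
  trans (sym (decode-encode α)) (trans (cong decode eq) (decode-encode β))

_≟_ : DecidableEquality Assertion
α ≟ β = map′ encode-injective (cong encode) (≟-code (encode α) (encode β))
  where
  ≟-ℕ² : DecidableEquality (ℕ × ℕ)
  ≟-ℕ² = Product.≡-dec ℕ._≟_ ℕ._≟_
  ≟-ℕ³ : DecidableEquality (ℕ × ℕ × ℕ)
  ≟-ℕ³ = Product.≡-dec ℕ._≟_ ≟-ℕ²
  ≟-code : DecidableEquality AssertionCode
  ≟-code = Sum.≡-dec ≟-ℕ² (Sum.≡-dec ≟-ℕ³ (Sum.≡-dec ≟-ℕ² ≟-ℕ³))

open import Data.List.Membership.DecPropositional _≟_ using (_∈?_)

Satisfiable : Base → Set₁
Satisfiable B = ∃ (Mod B)

clash : Base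
clash = cpos 0 0 ∷ cneg 0 0 ∷ []

clash-unsatisfiable : ∀ {I} → ¬ Mod clash I
clash-unsatisfiable (A₀a ∷ ¬A₀a ∷ []) = ¬A₀a A₀a

Mod-antitone : ∀ {B B′} → B′ List.⊆ B → Mod B ⊆ Mod B′
Mod-antitone B′⊆B = anti-mono B′⊆B

canonical : Base → Assertion → Interpretation
canonical B α = record
  { Δ    = ℕ
  ; elt  = 0
  ; conc = λ A a → cpos A a ∈ B ⊎ α ≡ cneg A a
  ; role = λ r a b → rpos r a b ∈ B ⊎ α ≡ rneg r a b
  ; ind  = λ a → a
  }

canonical-refutes : ∀ B α → ¬ α ∈ B → ¬ (canonical B α ⊨ α)
canonical-refutes B (cpos A a)   α∉B (inj₁ α∈B) = α∉B α∈B
canonical-refutes B (cpos A a)   _   (inj₂ ())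
canonical-refutes B (rpos r a b) α∉B (inj₁ α∈B) = α∉B α∈B
canonical-refutes B (rpos r a b) _   (inj₂ ())
canonical-refutes B (cneg A a)   _   ¬A = ¬A (inj₂ refl)
canonical-refutes B (rneg r a b) _   ¬r = ¬r (inj₂ refl)

-- A negative assertion of B holds since satisfiable B lacks its positive counterpart and α ∉ B.
canonical-satisfies : ∀ {B} α → Satisfiable B → ¬ α ∈ B → Mod B (canonical B α)
canonical-satisfies {B} α (I , I⊨B) α∉B = All.tabulate holds
  where
  holds : ∀ {β} → β ∈ B → canonical B α ⊨ β
  holds {cpos A a}   β∈B = inj₁ β∈B
  holds {rpos r a b} β∈B = inj₁ β∈B
  holds {cneg A a}   β∈B (inj₁ A∈B)  = All.lookup I⊨B β∈B (All.lookup I⊨B A∈B)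
  holds {cneg A a}   β∈B (inj₂ refl) = α∉B β∈B
  holds {rneg r a b} β∈B (inj₁ r∈B)  = All.lookup I⊨B β∈B (All.lookup I⊨B r∈B)
  holds {rneg r a b} β∈B (inj₂ refl) = α∉B β∈B

Mod-⊆⇒⊇ : ∀ {B B′} → Satisfiable B → Mod B ⊆ Mod B′ → B′ List.⊆ B
Mod-⊆⇒⊇ {B} sat B⊨B′ {α} α∈B′ with α ∈? B
... | yes α∈B = α∈B
... | no  α∉B = contradiction (All.lookup (B⊨B′ (canonical-satisfies α sat α∉B)) α∈B′)
                              (canonical-refutes B α α∉B)

Mod-InFR : ∀ B → InFR (Mod B)
Mod-InFR B = B , (λ I⊨B → I⊨B) , (λ I⊨B → I⊨B)

SatisfiableWithin : ModelSet → Base → Set₁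
SatisfiableWithin T B = Satisfiable B × Mod B ⊆ T

⊆-or-filter-shorter : ∀ B′ B″ → B′ List.⊆ B″ ⊎ length (filter (_∈? B″) B′) < length B′
⊆-or-filter-shorter B′ B″ with All.all? (_∈? B″) B′
... | yes B′⊆B″ = inj₁ (All.lookup B′⊆B″)
... | no  B′⊈B″ = inj₂ (filter-notAll (_∈? B″) B′ (¬All⇒Any¬ (_∈? B″) B′ B′⊈B″))

Mod-filter-∈ : ∀ {B′ B″} → B″ List.⊆ B′ → Mod (filter (_∈? B″) B′) ≐ Mod B″
Mod-filter-∈ {B′} {B″} B″⊆B′ =
  Mod-antitone (λ β∈B″ → ∈-filter⁺ (_∈? B″) (B″⊆B′ β∈B″) β∈B″) ,
  Mod-antitone (proj₂ ∘ ∈-filter⁻ (_∈? B″) {xs = B′})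

-- A finitely representable Y between Mod B′ and T is Mod B″ with B″ ⊆ B′ as sets; filtering
-- B′ down to B″ gives an equivalent base, which cannot be shorter, so B′ ⊆ B″ too.
shortest-isFRsub : ∀ {T B′} → SatisfiableWithin T B′ →
                   (∀ {B″} → SatisfiableWithin T B″ → length B′ ≤ length B″) →
                   IsFRsub T (Mod B′)
shortest-isFRsub {T} {B′} (sat , B′⊆T) shortest = Mod-InFR B′ , B′⊆T , maximal
  where
  maximal : ∀ Y → InFR Y → Y ⊆ T → Mod B′ ⊆ Y → Y ⊆ Mod B′
  maximal Y (B″ , Y⊆B″ , B″⊆Y) Y⊆T B′⊆Y with ⊆-or-filter-shorter B′ B″
  ... | inj₁ B′⊆ˡB″  = Mod-antitone B′⊆ˡB″ ∘ Y⊆B″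
  ... | inj₂ shorter = contradiction (<-≤-trans shorter (shortest filtered-within)) (n≮n _)
    where
    filtered≐B″ : Mod (filter (_∈? B″) B′) ≐ Mod B″
    filtered≐B″ = Mod-filter-∈ (Mod-⊆⇒⊇ sat (Y⊆B″ ∘ B′⊆Y))
    filtered-within : SatisfiableWithin T (filter (_∈? B″) B′)
    filtered-within = (proj₁ sat , proj₂ filtered≐B″ (Y⊆B″ (B′⊆Y (proj₂ sat))))
                    , Y⊆T ∘ B″⊆Y ∘ proj₁ filtered≐B″

empty-isFRsub : ∀ {T} → ¬ ∃ (SatisfiableWithin T) → IsFRsub T (Mod clash)
empty-isFRsub none = Mod-InFR clash , (λ I⊨clash → ⊥-elim (clash-unsatisfiable I⊨clash)) ,
  λ { Y (B , Y⊆B , B⊆Y) Y⊆T _ {I} I∈Y →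
        ⊥-elim (none (B , (I , Y⊆B I∈Y) , λ J⊨B → Y⊆T (B⊆Y J⊨B))) }

eviction : ExcludedMiddle (lsuc 0ℓ) → EvictionCompatible
eviction lem B 𝕄 with lem {∃ (SatisfiableWithin (Mod B ∖ 𝕄))}
... | no  none = Mod clash , empty-isFRsub none
... | yes some with lem⇒minimal lem length some
...   | B′ , within , shortest = Mod B′ , shortest-isFRsub within shortest

A₀-everywhere : Interpretation
A₀-everywhere = record
  { Δ = ℕ ; elt = 0 ; conc = λ A a → A ≡ 0 ; role = λ _ _ _ → ⊥ ; ind = λ a → a }

A₀-except : ℕ → Interpretation
A₀-except k = record
  { Δ = ℕ ; elt = 0 ; conc = λ A a → A ≡ 0 × ¬ a ≡ k ; role = λ _ _ _ → ⊥ ; ind = λ a → a }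

conceptIndividual : Assertion → ℕ
conceptIndividual (cpos A a)   = a
conceptIndividual (rpos r a b) = 0
conceptIndividual (cneg A a)   = a
conceptIndividual (rneg r a b) = 0

fresh : Base → ℕ
fresh B = suc (sum (map conceptIndividual B))

conceptIndividual<fresh : ∀ {α B} → α ∈ B → conceptIndividual α < fresh B
conceptIndividual<fresh {α} {_ ∷ B} (here refl) = s≤s (m≤m+n (conceptIndividual α) _)
conceptIndividual<fresh {B = β ∷ B} (there α∈B) =
  ≤-trans (conceptIndividual<fresh α∈B) (s≤s (m≤n+m _ (conceptIndividual β)))

A₀-except-satisfies : ∀ {k} α → ¬ conceptIndividual α ≡ k →
                      A₀-everywhere ⊨ α → A₀-except k ⊨ α
A₀-except-satisfies (cpos A a)   a≢k A≡0 = A≡0 , a≢k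
A₀-except-satisfies (rpos r a b) _   ()
A₀-except-satisfies (cneg A a)   _   A≢0 = A≢0 ∘ proj₁
A₀-except-satisfies (rneg r a b) _   _   = λ ()

A₀-except-fresh : ∀ B → Mod B A₀-everywhere → Mod B (A₀-except (fresh B))
A₀-except-fresh B A₀⊨B = All.tabulate λ {α} α∈B →
  A₀-except-satisfies α (<⇒≢ (conceptIndividual<fresh α∈B)) (All.lookup A₀⊨B α∈B)

EveryIndividualInA₀ : ModelSet
EveryIndividualInA₀ I = ∀ a → conc I 0 (ind I a)

¬reception : ¬ ReceptionCompatible
¬reception reception with reception clash EveryIndividualInA₀
... | Y , (B , Y⊆B , B⊆Y) , covers , minimal = proj₂ (All.lookup A₀-except-k∈Y′ (here refl)) refl
  where
  k : ℕ
  k = fresh B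
  Y′ : ModelSet
  Y′ = Mod (cpos 0 k ∷ B)
  covers′ : Mod clash ∪ EveryIndividualInA₀ ⊆ Y′
  covers′ (inj₁ I⊨clash)  = contradiction I⊨clash clash-unsatisfiable
  covers′ (inj₂ A₀-on-I) = A₀-on-I k ∷ Y⊆B (covers (inj₂ A₀-on-I))
  A₀-except-k∈Y : Y (A₀-except k)
  A₀-except-k∈Y = B⊆Y (A₀-except-fresh B (Y⊆B (covers {A₀-everywhere} (inj₂ λ _ → refl))))
  A₀-except-k∈Y′ : Y′ (A₀-except k)
  A₀-except-k∈Y′ = minimal Y′ (Mod-InFR _) covers′ (B⊆Y ∘ All.tail) A₀-except-k∈Y

theorem10 : ExcludedMiddle (lsuc 0ℓ) → ¬ ReceptionCompatible × EvictionCompatible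
theorem10 lem = ¬reception , eviction lem
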